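{- Let $q=p^r$ with $p$ prime and $r$ a positive integer. The number $N$ of points in $\mathbb{P}^2(\mathbb{F}_{q^2})$ on the curve $u^{q-1}+v^{q-1}+w^{q-1}=0$ is \[ N=\begin{cases} 3(q-1) & \text{if } q\equiv 1\pmod 3,\\ 3(q-1)+(q-1)^2 & \text{if } q\equiv 0\pmod 3,\\ 3(q-1)+2(q-1)^2 & \text{if } q\equiv 2\pmod 3. \end{cases} \]
   Context: $\mathbb{P}^2(\mathbb{F}_{q^2})$ is the projective plane over the finite field with $q^2$ elements. -}

module Defs where

open import Data.Nat using (ℕ; zero; suc; _∸_; _^_)
open import Data.Fin using (Fin; _≟_)
open import Data.Fin.Base using ()
open import Data.List using (List; []; _∷_; _++_; map; concatMap; filter; length; allFin)
open import Data.Product using (_×_; _,_; ∃)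
open import Relation.Binary.PropositionalEquality using (_≡_; _≢_)
open import Algebra.Structures using (IsCommutativeRing)

record FiniteField (n : ℕ) : Set where
  field
    _+_ _*_ : Fin n → Fin n → Fin n
    -_      : Fin n → Fin n
    0# 1#   : Fin n
    isCommutativeRing : IsCommutativeRing _≡_ _+_ _*_ -_ 0# 1#
    0≢1     : 0# ≢ 1#
    inverse : ∀ x → x ≢ 0# → ∃ λ y → x * y ≡ 1#

  infixl 6 _+_
  infixl 7 _*_

  pow : Fin n → ℕ → Fin n
  pow x zero    = 1#
  pow x (suc k) = x * pow x k

  -- The points of P²(F), one normalised representative per point:
  -- [1 : v : w], [0 : 1 : w], [0 : 0 : 1].
  projPoints : List (Fin n × Fin n × Fin n)
  projPoints =
    concatMap (λ v → map (λ w → (1# , v , w)) (allFin n)) (allFin n)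
    ++ map (λ w → (0# , 1# , w)) (allFin n)
    ++ ((0# , 0# , 1#) ∷ [])

  -- Number of points of P²(F) on the curve u^e + v^e + w^e = 0
  -- (the equation is homogeneous, so this is independent of representatives).
  curvePointCount : ℕ → ℕ
  curvePointCount e =
    length (filter (λ { (u , v , w) → (pow u e + pow v e + pow w e) ≟ 0# }) projPoints)

{-# OPTIONS --safe #-}
-- Write e = q - 1 and μ for the (q + 1)-th roots of unity in F = F_{q²}. The map x ↦ x^e sends the
-- q² - 1 units onto μ with fibres of size e, so s + w^e = 0 has [s = 0] + e [-s ∈ μ] solutions w.
-- Summing over the points [1 : v : w] and [0 : 1 : w] gives N = 3e + S e², where S counts the c ∈ μ
-- with -(1 + c) ∈ μ. As c^q = c⁻¹ on μ, the Frobenius turns this condition into c² + c + 1 = 0, whose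
-- roots in μ are: none if q ≡ 1 (mod 3); only c = 1 in characteristic 3; and both primitive cube
-- roots of unity, which lie in μ because 3 ∣ q + 1, if q ≡ 2 (mod 3).
module Submission where

open import Defs
open import Data.Nat as ℕ using (ℕ; _≤_)
open import Data.Nat.Primality using (Prime)

module Counting where

  open import Data.Nat using (ℕ; suc; _+_; _*_; _∸_; _≤_; z≤n)
  open import Data.Nat.Properties
  open import Algebra.Properties.CommutativeSemigroup +-commutativeSemigroup using (interchange; xy∙z≈xz∙y)
  open import Data.Nat.ListAction using (sum)
  open import Data.List using (List; []; _∷_; _++_; map; concatMap; filter; length)
  open import Data.List.Properties using (filter-++; length-++; filter-none; map-cong-local)
  open import Data.List.Relation.Unary.All as All using (All; _∷_)
  open import Data.List.Relation.Unary.Any using (here; there)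
  open import Data.List.Relation.Unary.Unique.Propositional using (Unique; _∷_)
  import Data.List.Relation.Unary.Unique.Propositional.Properties as Unique
  open import Data.List.Relation.Binary.Permutation.Propositional using (_↭_)
  open import Data.List.Relation.Binary.Permutation.Propositional.Properties using (filter-↭; ↭-length)
  open import Data.List.Relation.Binary.BagAndSetEquality using (∼bag⇒↭)
  open import Data.List.Membership.Propositional using (_∈_)
  open import Data.List.Membership.Propositional.Properties using (∈-map⁺; ∈-map⁻)
  open import Data.List.Membership.Propositional.Properties.WithK using (unique∧set⇒bag)
  open import Data.Product using (∃-syntax; _×_; _,_)
  open import Function using (_∘_; _⇔_; Equivalence; mk⇔)
  open import Relation.Nullary using (Dec; yes; no; ¬_; contradiction)
  open import Relation.Unary using (Pred; Decidable; ∁)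
  open import Relation.Unary.Properties using (_∪?_)
  open import Relation.Binary.Definitions using (DecidableEquality)
  open import Relation.Binary.PropositionalEquality

  indicator : ∀ {p} {P : Set p} → Dec P → ℕ
  indicator (yes _) = 1
  indicator (no _)  = 0

  indicator-yes : ∀ {p} {P : Set p} (P? : Dec P) → P → indicator P? ≡ 1
  indicator-yes (yes _) _ = refl
  indicator-yes (no ¬p) p = contradiction p ¬p

  indicator-no : ∀ {p} {P : Set p} (P? : Dec P) → ¬ P → indicator P? ≡ 0
  indicator-no (yes p) ¬p = contradiction p ¬p
  indicator-no (no _)  _  = refl

  indicator-cong : ∀ {p q} {P : Set p} {Q : Set q} (P? : Dec P) (Q? : Dec Q) →
                   P ⇔ Q → indicator P? ≡ indicator Q?
  indicator-cong (yes _) (yes _) _   = refl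
  indicator-cong (yes p) (no ¬q) P⇔Q = contradiction (Equivalence.to P⇔Q p) ¬q
  indicator-cong (no ¬p) (yes q) P⇔Q = contradiction (Equivalence.from P⇔Q q) ¬p
  indicator-cong (no _)  (no _)  _   = refl

  module _ {a p} {A : Set a} {P : Pred A p} (P? : Decidable P) where

    count : List A → ℕ
    count xs = length (filter P? xs)

    count-∷ : ∀ x xs → count (x ∷ xs) ≡ indicator (P? x) + count xs
    count-∷ x xs with P? x
    ... | yes _ = refl
    ... | no _  = refl

    count-++ : ∀ xs ys → count (xs ++ ys) ≡ count xs + count ys
    count-++ xs ys = trans (cong length (filter-++ P? xs ys)) (length-++ (filter P? xs))

    count-concatMap : ∀ {b} {B : Set b} (f : B → List A) ys →
                      count (concatMap f ys) ≡ sum (map (count ∘ f) ys)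
    count-concatMap f []       = refl
    count-concatMap f (y ∷ ys) =
      trans (count-++ (f y) (concatMap f ys)) (cong (count (f y) +_) (count-concatMap f ys))

    count-none : ∀ {xs} → All (∁ P) xs → count xs ≡ 0
    count-none ¬Ps = cong length (filter-none P? ¬Ps)

    count-↭ : ∀ {xs ys} → xs ↭ ys → count xs ≡ count ys
    count-↭ = ↭-length ∘ filter-↭ P?

    count≡sum-indicator : ∀ xs → count xs ≡ sum (map (indicator ∘ P?) xs)
    count≡sum-indicator []       = refl
    count≡sum-indicator (x ∷ xs) =
      trans (count-∷ x xs) (cong (indicator (P? x) +_) (count≡sum-indicator xs))

  count-map : ∀ {a b p} {A : Set a} {B : Set b} {P : Pred A p} (P? : Decidable P) (f : B → A) ys →
              count P? (map f ys) ≡ count (P? ∘ f) ys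
  count-map P? f []       = refl
  count-map P? f (y ∷ ys) = begin
    count P? (f y ∷ map f ys)                  ≡⟨ count-∷ P? (f y) (map f ys) ⟩
    indicator (P? (f y)) + count P? (map f ys) ≡⟨ cong (indicator (P? (f y)) +_) (count-map P? f ys) ⟩
    indicator (P? (f y)) + count (P? ∘ f) ys   ≡⟨ count-∷ (P? ∘ f) y ys ⟨
    count (P? ∘ f) (y ∷ ys)                    ∎
    where open ≡-Reasoning

  count-cong : ∀ {a p q} {A : Set a} {P : Pred A p} {Q : Pred A q}
               (P? : Decidable P) (Q? : Decidable Q) xs →
               (∀ {x} → x ∈ xs → P x ⇔ Q x) → count P? xs ≡ count Q? xs
  count-cong P? Q? []       _   = refl
  count-cong P? Q? (x ∷ xs) P⇔Q = begin
    count P? (x ∷ xs)              ≡⟨ count-∷ P? x xs ⟩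
    indicator (P? x) + count P? xs ≡⟨ cong₂ _+_ (indicator-cong (P? x) (Q? x) (P⇔Q (here refl)))
                                                (count-cong P? Q? xs (P⇔Q ∘ there)) ⟩
    indicator (Q? x) + count Q? xs ≡⟨ count-∷ Q? x xs ⟨
    count Q? (x ∷ xs)              ∎
    where open ≡-Reasoning

  count-∪ : ∀ {a p q} {A : Set a} {P : Pred A p} {Q : Pred A q}
            (P? : Decidable P) (Q? : Decidable Q) → (∀ {x} → P x → ¬ Q x) →
            ∀ xs → count (P? ∪? Q?) xs ≡ count P? xs + count Q? xs
  count-∪ P? Q? disjoint []       = refl
  count-∪ P? Q? disjoint (x ∷ xs) with P? x | Q? x | count-∪ P? Q? disjoint xs
  ... | yes px | yes qx | _  = contradiction qx (disjoint px)
  ... | yes _  | no _   | eq = cong suc eq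
  ... | no _   | yes _  | eq = trans (cong suc eq) (sym (+-suc _ _))
  ... | no _   | no _   | eq = eq

  map-↭ : ∀ {a} {A : Set a} {f : A → A} {xs} → Unique xs → (∀ {x y} → f x ≡ f y → x ≡ y) →
          (∀ {x} → x ∈ xs → f x ∈ xs) → (∀ {y} → y ∈ xs → ∃[ x ] x ∈ xs × f x ≡ y) →
          map f xs ↭ xs
  map-↭ {f = f} {xs} xs! f-injective f∈ f-onto =
    ∼bag⇒↭ (unique∧set⇒bag (Unique.map⁺ f-injective xs!) xs! (mk⇔ into onto))
    where
    into : ∀ {y} → y ∈ map f xs → y ∈ xs
    into y∈ with ∈-map⁻ f y∈
    ... | x , x∈xs , refl = f∈ x∈xs
    onto : ∀ {y} → y ∈ xs → y ∈ map f xs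
    onto y∈xs with f-onto y∈xs
    ... | x , x∈xs , refl = ∈-map⁺ f x∈xs

  module _ {a} {A : Set a} where

    sum-map-cong : ∀ {f g : A → ℕ} xs → (∀ {x} → x ∈ xs → f x ≡ g x) →
                   sum (map f xs) ≡ sum (map g xs)
    sum-map-cong _ f≡g = cong sum (map-cong-local (All.tabulate f≡g))

    sum-map-0 : ∀ xs → sum (map (λ (_ : A) → 0) xs) ≡ 0
    sum-map-0 []       = refl
    sum-map-0 (_ ∷ xs) = sum-map-0 xs

    sum-map-+ : ∀ (f g : A → ℕ) xs → sum (map (λ x → f x + g x) xs) ≡ sum (map f xs) + sum (map g xs)
    sum-map-+ f g []       = refl
    sum-map-+ f g (x ∷ xs) =
      trans (cong (f x + g x +_) (sum-map-+ f g xs)) (interchange (f x) (g x) (sum (map f xs)) (sum (map g xs)))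

    sum-map-*ˡ : ∀ k (f : A → ℕ) xs → sum (map (λ x → k * f x) xs) ≡ k * sum (map f xs)
    sum-map-*ˡ k f []       = sym (*-zeroʳ k)
    sum-map-*ˡ k f (x ∷ xs) =
      trans (cong (k * f x +_) (sum-map-*ˡ k f xs)) (sym (*-distribˡ-+ k (f x) (sum (map f xs))))

    sum-map-≤ : ∀ {f : A → ℕ} {k} xs → (∀ {x} → x ∈ xs → f x ≤ k) → sum (map f xs) ≤ k * length xs
    sum-map-≤ []                 _   = z≤n
    sum-map-≤ {f} {k} (x ∷ xs) f≤k = begin
      f x + sum (map f xs) ≤⟨ +-mono-≤ (f≤k (here refl)) (sum-map-≤ xs (f≤k ∘ there)) ⟩
      k + k * length xs    ≡⟨ *-suc k (length xs) ⟨
      k * length (x ∷ xs)  ∎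
      where open ≤-Reasoning

    sum-map-+∸-≤ : ∀ {f : A → ℕ} {k} xs → (∀ {x} → x ∈ xs → f x ≤ k) →
                   ∀ {y} → y ∈ xs → sum (map f xs) + (k ∸ f y) ≤ k * length xs
    sum-map-+∸-≤ {f} {k} (x ∷ xs) f≤k (here refl) = begin
      f x + sum (map f xs) + (k ∸ f x) ≡⟨ xy∙z≈xz∙y (f x) (sum (map f xs)) (k ∸ f x) ⟩
      f x + (k ∸ f x) + sum (map f xs) ≡⟨ cong (_+ sum (map f xs)) (m+[n∸m]≡n (f≤k (here refl))) ⟩
      k + sum (map f xs)               ≤⟨ +-monoʳ-≤ k (sum-map-≤ xs (f≤k ∘ there)) ⟩
      k + k * length xs                ≡⟨ *-suc k (length xs) ⟨
      k * length (x ∷ xs)              ∎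
      where open ≤-Reasoning
    sum-map-+∸-≤ {f} {k} (x ∷ xs) f≤k {y} (there y∈xs) = begin
      f x + sum (map f xs) + (k ∸ f y)   ≡⟨ +-assoc (f x) (sum (map f xs)) (k ∸ f y) ⟩
      f x + (sum (map f xs) + (k ∸ f y)) ≤⟨ +-mono-≤ (f≤k (here refl))
                                                      (sum-map-+∸-≤ xs (f≤k ∘ there) y∈xs) ⟩
      k + k * length xs                  ≡⟨ *-suc k (length xs) ⟨
      k * length (x ∷ xs)                ∎
      where open ≤-Reasoning

    sum-map-saturated : ∀ {f : A → ℕ} {k m} xs → (∀ {x} → x ∈ xs → f x ≤ k) →
                        length xs ≤ m → sum (map f xs) ≡ k * m → ∀ {y} → y ∈ xs → f y ≡ k
    sum-map-saturated {f} {k} {m} xs f≤k len≤m sum≡k*m {y} y∈xs =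
      ≤-antisym (f≤k y∈xs) (m∸n≡0⇒m≤n (n≤0⇒n≡0 (+-cancelˡ-≤ (k * m) (k ∸ f y) 0 bound)))
      where
      bound : k * m + (k ∸ f y) ≤ k * m + 0
      bound = begin
        k * m + (k ∸ f y)          ≡⟨ cong (_+ (k ∸ f y)) sum≡k*m ⟨
        sum (map f xs) + (k ∸ f y) ≤⟨ sum-map-+∸-≤ xs f≤k y∈xs ⟩
        k * length xs              ≤⟨ *-monoʳ-≤ k len≤m ⟩
        k * m                      ≡⟨ +-identityʳ (k * m) ⟨
        k * m + 0                  ∎
        where open ≤-Reasoning

  module _ {a} {A : Set a} (_≟_ : DecidableEquality A) where

    private
      ∉-tail : ∀ {x y : A} {ys} → All (λ z → ¬ x ≡ z) ys → y ∈ ys → ¬ y ≡ x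
      ∉-tail (x≢z ∷ _)  (here refl)  refl = x≢z refl
      ∉-tail (_ ∷ x≢zs) (there y∈ys)      = ∉-tail x≢zs y∈ys

    sum-map-indicator-* : ∀ (h : A → ℕ) {xs d} → Unique xs → d ∈ xs →
                          sum (map (λ x → indicator (x ≟ d) * h x) xs) ≡ h d
    sum-map-indicator-* h {x ∷ xs} (x∉xs ∷ _) (here refl) with x ≟ x
    ... | no x≢x = contradiction refl x≢x
    ... | yes _  = trans (cong (h x + 0 +_) (trans (sum-map-cong xs term≡0) (sum-map-0 xs)))
                         (trans (+-identityʳ _) (+-identityʳ (h x)))
      where
      term≡0 : ∀ {y} → y ∈ xs → indicator (y ≟ x) * h y ≡ 0
      term≡0 {y} y∈xs with y ≟ x
      ... | yes y≡x = contradiction y≡x (∉-tail x∉xs y∈xs)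
      ... | no _    = refl
    sum-map-indicator-* h {x ∷ xs} {d} (x∉xs ∷ xs!) (there d∈xs) with x ≟ d
    ... | yes refl = contradiction refl (∉-tail x∉xs d∈xs)
    ... | no _     = sum-map-indicator-* h xs! d∈xs

    count-≡-unique : ∀ {xs d} → Unique xs → d ∈ xs → count (_≟ d) xs ≡ 1
    count-≡-unique {xs} {d} xs! d∈xs = begin
      count (_≟ d) xs                            ≡⟨ count≡sum-indicator (_≟ d) xs ⟩
      sum (map (λ x → indicator (x ≟ d)) xs)     ≡⟨ sum-map-cong xs (λ _ → sym (*-identityʳ _)) ⟩
      sum (map (λ x → indicator (x ≟ d) * 1) xs) ≡⟨ sum-map-indicator-* (λ _ → 1) xs! d∈xs ⟩
      1                                          ∎
      where open ≡-Reasoning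

    sum-map-fibres : ∀ {b} {B : Set b} (g : B → A) (h : A → ℕ) ys {xs} → Unique xs →
                     (∀ {y} → y ∈ ys → g y ∈ xs) →
                     sum (map (h ∘ g) ys) ≡ sum (map (λ x → count (λ y → x ≟ g y) ys * h x) xs)
    sum-map-fibres g h []       {xs} _   _  = sym (sum-map-0 xs)
    sum-map-fibres g h (y ∷ ys) {xs} xs! g∈ = begin
      h (g y) + sum (map (h ∘ g) ys)
        ≡⟨ cong₂ _+_ (sym (sum-map-indicator-* h xs! (g∈ (here refl)))) (sum-map-fibres g h ys xs! (g∈ ∘ there)) ⟩
      sum (map (λ x → indicator (x ≟ g y) * h x) xs) + sum (map (λ x → #ys x * h x) xs)
        ≡⟨ sum-map-+ _ _ xs ⟨
      sum (map (λ x → indicator (x ≟ g y) * h x + #ys x * h x) xs)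
        ≡⟨ sum-map-cong xs (λ {x} _ → sym (*-distribʳ-+ (h x) (indicator (x ≟ g y)) (#ys x))) ⟩
      sum (map (λ x → (indicator (x ≟ g y) + #ys x) * h x) xs)
        ≡⟨ sum-map-cong xs (λ {x} _ → cong (_* h x) (count-∷ (λ y → x ≟ g y) y ys)) ⟨
      sum (map (λ x → count (λ y → x ≟ g y) (y ∷ ys) * h x) xs) ∎
      where
      open ≡-Reasoning
      #ys : A → ℕ
      #ys x = count (λ y → x ≟ g y) ys

module NatLemmas where

  open import Data.Nat
  open import Data.Nat.Properties
  open import Data.Nat.Divisibility
  open import Data.Nat.DivMod using (m/n*n≡m)
  open import Data.Nat.Primality using (Prime; prime?; euclidsLemma; prime⇒nonTrivial; prime⇒nonZero)
  open import Data.Nat.Combinatorics using (_C_; nCk≡n!/k![n-k]!; k![n∸k]!∣n!)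
  open import Data.Nat.Tactic.RingSolver using (solve-∀)
  open import Data.Sum using (inj₁; inj₂)
  open import Relation.Nullary using (contradiction)
  open import Relation.Nullary.Decidable using (toWitness)
  open import Relation.Binary.PropositionalEquality

  prime[3] : Prime 3
  prime[3] = toWitness {a? = prime? 3} _

  prime⇒≥2 : ∀ {p} → Prime p → 2 ≤ p
  prime⇒≥2 {p} p-prime = nonTrivial⇒n>1 p {{prime⇒nonTrivial p-prime}}

  prime∤m! : ∀ {p} → Prime p → ∀ m → m < p → p ∤ m !
  prime∤m! p-prime zero    _   p∣1 = <⇒≱ (prime⇒≥2 p-prime) (∣⇒≤ p∣1)
  prime∤m! p-prime (suc m) m<p p∣[1+m]! with euclidsLemma (suc m) (m !) p-prime p∣[1+m]!
  ... | inj₁ p∣1+m = <⇒≱ m<p (∣⇒≤ p∣1+m)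
  ... | inj₂ p∣m!  = prime∤m! p-prime m (<-trans (n<1+n m) m<p) p∣m!

  n∣n! : ∀ n .{{_ : NonZero n}} → n ∣ n !
  n∣n! (suc m) = m∣m*n (m !)

  -- p divides p! = (p C k) k! (p - k)! but neither factorial.
  prime∣pCk : ∀ {p k} → Prime p → 0 < k → k < p → p ∣ p C k
  prime∣pCk {p} {k} p-prime 0<k k<p with euclidsLemma (p C k) (k ! * (p ∸ k) !) p-prime p∣pCk*k!*[p∸k]!
    where
    instance _ = k !* (p ∸ k) !≢0
    p∣pCk*k!*[p∸k]! : p ∣ (p C k) * (k ! * (p ∸ k) !)
    p∣pCk*k!*[p∸k]! = subst (p ∣_) (sym (begin
      (p C k) * (k ! * (p ∸ k) !)                 ≡⟨ cong (_* (k ! * (p ∸ k) !)) (nCk≡n!/k![n-k]! (<⇒≤ k<p)) ⟩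
      p ! / (k ! * (p ∸ k) !) * (k ! * (p ∸ k) !) ≡⟨ m/n*n≡m (k![n∸k]!∣n! (<⇒≤ k<p)) ⟩
      p !                                         ∎)) (n∣n! p {{prime⇒nonZero p-prime}})
      where open ≡-Reasoning
  ... | inj₁ p∣pCk = p∣pCk
  ... | inj₂ p∣k!*[p∸k]! with euclidsLemma (k !) ((p ∸ k) !) p-prime p∣k!*[p∸k]!
  ...   | inj₁ p∣k!     = contradiction p∣k! (prime∤m! p-prime k k<p)
  ...   | inj₂ p∣[p∸k]! = contradiction p∣[p∸k]! (prime∤m! p-prime (p ∸ k) (∸-monoʳ-< 0<k (<⇒≤ k<p)))

  prime∣m^k⇒prime∣m : ∀ {d} m k → Prime d → d ∣ m ^ k → d ∣ m
  prime∣m^k⇒prime∣m m zero    d-prime d∣1   = contradiction (∣⇒≤ d∣1) (<⇒≱ (prime⇒≥2 d-prime))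
  prime∣m^k⇒prime∣m m (suc k) d-prime d∣m^k with euclidsLemma m (m ^ k) d-prime d∣m^k
  ... | inj₁ d∣m   = d∣m
  ... | inj₂ d∣m^k = prime∣m^k⇒prime∣m m k d-prime d∣m^k

  -- The ring solver does not know _^_, so the squares are written out as m * (m * 1).
  [1+m]²∸1≡m*[2+m] : ∀ m → (1 + m) ^ 2 ∸ 1 ≡ m * (2 + m)
  [1+m]²∸1≡m*[2+m] m = cong (_∸ 1) ([1+m]²≡1+m*[2+m] m)
    where
    [1+m]²≡1+m*[2+m] : ∀ m → (1 + m) * ((1 + m) * 1) ≡ 1 + m * (2 + m)
    [1+m]²≡1+m*[2+m] = solve-∀

  m+m*[1+m*s]+m≡3m+s*m² : ∀ m s → m + m * (1 + m * s) + m ≡ 3 * m + s * m ^ 2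
  m+m*[1+m*s]+m≡3m+s*m² = identity
    where
    identity : ∀ m s → m + m * (1 + m * s) + m ≡ 3 * m + s * (m * (m * 1))
    identity = solve-∀

module FieldProperties {n : ℕ} (F : FiniteField n) where

  open Counting using (map-↭)
  open NatLemmas using (prime∣pCk)
  open import Data.Nat as ℕ using (zero; suc; _∸_; _<_; z≤n; s≤s)
  import Data.Nat.Properties as ℕ
  open import Data.Nat.Divisibility using (divides)
  open import Data.Nat.Primality using (¬prime[0])
  open import Data.Nat.Combinatorics using (_C_; nCn≡1)
  open import Data.Fin using (Fin; _≟_; zero; suc; inject₁; fromℕ; toℕ)
  open import Data.Fin.Properties using (toℕ-fromℕ; toℕ-inject₁; toℕ<n)
  open import Data.List using (List; []; _∷_; length; map; filter; foldr; replicate; allFin)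
  open import Data.List.Properties using (length-replicate; length-tabulate)
  open import Data.List.Relation.Unary.All as All using (All; _∷_)
  import Data.List.Relation.Unary.All.Properties as All
  open import Data.List.Relation.Unary.Any using (here; there)
  open import Data.List.Relation.Unary.Unique.Propositional using (Unique; _∷_)
  import Data.List.Relation.Unary.Unique.Propositional.Properties as Unique
  open import Data.List.Membership.Propositional using (_∈_; find)
  open import Data.List.Membership.Propositional.Properties using (∈-filter⁺; ∈-filter⁻; ∈-allFin)
  open import Data.List.Membership.Propositional.Properties.WithK using (unique∧set⇒bag)
  open import Data.List.Relation.Binary.BagAndSetEquality using (∼bag⇒↭)
  open import Data.List.Relation.Binary.Permutation.Propositional using (_↭_; ↭⇒↭ₛ)
  open import Data.List.Relation.Binary.Permutation.Propositional.Properties using (↭-length)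
  open import Data.List.Relation.Binary.Permutation.Setoid.Properties using (foldr-commMonoid)
  open import Data.Maybe using (nothing)
  open import Data.Product using (Σ; ∃-syntax; _×_; _,_; proj₂)
  open import Data.Sum using (_⊎_; inj₁; inj₂)
  open import Function using (id; _∘_; mk⇔)
  open import Relation.Nullary using (yes; no; ¬?; contradiction)
  open import Relation.Binary.PropositionalEquality
  open import Algebra.Bundles using (CommutativeRing)
  import Algebra.Properties.CommutativeSemigroup as CommutativeSemigroupProperties
  open import Tactic.RingSolver.Core.AlmostCommutativeRing using (AlmostCommutativeRing; fromCommutativeRing)

  open FiniteField F public

  ring : CommutativeRing _ _
  ring = record { isCommutativeRing = isCommutativeRing }

  open CommutativeRing ring public
    using ( Carrier; +-assoc; +-comm; +-identityˡ; +-identityʳ; -‿inverseˡ; -‿inverseʳ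
          ; *-assoc; *-comm; *-identityˡ; *-identityʳ; zeroˡ; zeroʳ; distribˡ; distribʳ; semiring )
  open import Algebra.Properties.Ring (CommutativeRing.ring ring) public
    using ( -‿involutive; -‿distribˡ-*; -‿distribʳ-*; +-cancelʳ
          ; +-identityʳ-unique; +-inverseʳ-unique; x∙y⁻¹≈ε⇒x≈y )
  module +-CS = CommutativeSemigroupProperties (CommutativeRing.+-commutativeSemigroup ring)
  module *-CS = CommutativeSemigroupProperties (CommutativeRing.*-commutativeSemigroup ring)
  open import Algebra.Properties.Semiring.Exp semiring public
    using (_^_; ^-assocʳ)
  -- k · x is the k-fold sum x + ⋯ + x, so k · 1# is the image of k ∈ ℕ in F.
  open import Algebra.Properties.Semiring.Mult semiring public
    using (×1-homo-*; ×-assoc-*) renaming (_×_ to _·_)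

  almostCommutativeRing : AlmostCommutativeRing _ _
  almostCommutativeRing = fromCommutativeRing ring (λ _ → nothing)

  open import Tactic.RingSolver.NonReflective almostCommutativeRing using (solve; _⊜_; _⊕_; _⊗_)
  open ≡-Reasoning

  1≢0 : 1# ≢ 0#
  1≢0 = 0≢1 ∘ sym

  x*y≡0⇒x≡0⊎y≡0 : ∀ {x y} → x * y ≡ 0# → x ≡ 0# ⊎ y ≡ 0#
  x*y≡0⇒x≡0⊎y≡0 {x} {y} x*y≡0 with x ≟ 0#
  ... | yes x≡0 = inj₁ x≡0
  ... | no x≢0 with inverse x x≢0
  ... | x⁻¹ , x*x⁻¹≡1 = inj₂ (begin
    y             ≡⟨ *-identityˡ y ⟨
    1# * y        ≡⟨ cong (_* y) (trans (sym x*x⁻¹≡1) (*-comm x x⁻¹)) ⟩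
    x⁻¹ * x * y   ≡⟨ *-assoc x⁻¹ x y ⟩
    x⁻¹ * (x * y) ≡⟨ cong (x⁻¹ *_) x*y≡0 ⟩
    x⁻¹ * 0#      ≡⟨ zeroʳ x⁻¹ ⟩
    0#            ∎)

  *-≢0 : ∀ {x y} → x ≢ 0# → y ≢ 0# → x * y ≢ 0#
  *-≢0 x≢0 y≢0 x*y≡0 with x*y≡0⇒x≡0⊎y≡0 x*y≡0
  ... | inj₁ x≡0 = x≢0 x≡0
  ... | inj₂ y≡0 = y≢0 y≡0

  *-cancelˡ : ∀ {x y z} → x ≢ 0# → x * y ≡ x * z → y ≡ z
  *-cancelˡ {x} {y} {z} x≢0 x*y≡x*z with x*y≡0⇒x≡0⊎y≡0 x*[y-z]≡0
    where
    x*[y-z]≡0 : x * (y + - z) ≡ 0#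
    x*[y-z]≡0 = begin
      x * (y + - z)     ≡⟨ distribˡ x y (- z) ⟩
      x * y + x * - z   ≡⟨ cong₂ _+_ x*y≡x*z (sym (-‿distribʳ-* x z)) ⟩
      x * z + - (x * z) ≡⟨ -‿inverseʳ (x * z) ⟩
      0#                ∎
  ... | inj₁ x≡0   = contradiction x≡0 x≢0
  ... | inj₂ y-z≡0 = x∙y⁻¹≈ε⇒x≈y y z y-z≡0

  -x*-y≡x*y : ∀ x y → - x * - y ≡ x * y
  -x*-y≡x*y x y = begin
    - x * - y   ≡⟨ -‿distribˡ-* x (- y) ⟨
    - (x * - y) ≡⟨ cong -_ (-‿distribʳ-* x y) ⟨
    - - (x * y) ≡⟨ -‿involutive (x * y) ⟩
    x * y       ∎

  pow≗^ : ∀ x k → pow x k ≡ x ^ k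
  pow≗^ x zero    = refl
  pow≗^ x (suc k) = cong (x *_) (pow≗^ x k)

  1^k≡1 : ∀ k → 1# ^ k ≡ 1#
  1^k≡1 zero    = refl
  1^k≡1 (suc k) = trans (*-identityˡ _) (1^k≡1 k)

  0^k≡0 : ∀ {k} → 1 ≤ k → 0# ^ k ≡ 0#
  0^k≡0 {suc k} _ = zeroˡ _

  ^-≢0 : ∀ {x} k → x ≢ 0# → x ^ k ≢ 0#
  ^-≢0 zero    _   = 1≢0
  ^-≢0 (suc k) x≢0 = *-≢0 x≢0 (^-≢0 k x≢0)

  x^k≡0⇒x≡0 : ∀ {x} k → x ^ k ≡ 0# → x ≡ 0#
  x^k≡0⇒x≡0 {x} k x^k≡0 with x ≟ 0#
  ... | yes x≡0 = x≡0
  ... | no x≢0  = contradiction x^k≡0 (^-≢0 k x≢0)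

  x³≡1⇒x^[k*3]≡1 : ∀ {x} → x * (x * x) ≡ 1# → ∀ k → x ^ (k ℕ.* 3) ≡ 1#
  x³≡1⇒x^[k*3]≡1 {x} x³≡1 k = begin
    x ^ (k ℕ.* 3)     ≡⟨ cong (x ^_) (ℕ.*-comm k 3) ⟩
    x ^ (3 ℕ.* k)     ≡⟨ ^-assocʳ x 3 k ⟨
    (x ^ 3) ^ k       ≡⟨ cong (λ t → (x * (x * t)) ^ k) (*-identityʳ x) ⟩
    (x * (x * x)) ^ k ≡⟨ cong (_^ k) x³≡1 ⟩
    1# ^ k            ≡⟨ 1^k≡1 k ⟩
    1#                ∎

  ·≡·1* : ∀ k x → k · x ≡ (k · 1#) * x
  ·≡·1* k x = sym (trans (×-assoc-* k 1# x) (cong (k ·_) (*-identityˡ x)))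

  ·1-homo-^ : ∀ k m → (k ℕ.^ m) · 1# ≡ (k · 1#) ^ m
  ·1-homo-^ k zero    = +-identityʳ 1#
  ·1-homo-^ k (suc m) = trans (×1-homo-* k (k ℕ.^ m)) (cong (k · 1# *_) (·1-homo-^ k m))

  1*1+1+1≡3·1 : 1# * 1# + 1# + 1# ≡ 3 · 1#
  1*1+1+1≡3·1 = begin
    1# * 1# + 1# + 1#     ≡⟨ cong (λ t → t + 1# + 1#) (*-identityˡ 1#) ⟩
    1# + 1# + 1#          ≡⟨ +-assoc 1# 1# 1# ⟩
    1# + (1# + 1#)        ≡⟨ cong (λ t → 1# + (1# + t)) (+-identityʳ 1#) ⟨
    1# + (1# + (1# + 0#)) ∎

  -- [c₀, …, c_{d-1}] encodes the monic polynomial x^d + c_{d-1} x^{d-1} + ⋯ + c₀.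
  evalMonic : List Carrier → Carrier → Carrier
  evalMonic []       x = 1#
  evalMonic (c ∷ cs) x = c + x * evalMonic cs x

  -- Synthetic division by x - r: the quotient's coefficients are Horner values at r.
  quotient : List Carrier → Carrier → List Carrier
  quotient []           r = []
  quotient (c ∷ [])     r = []
  quotient (c ∷ d ∷ cs) r = evalMonic (d ∷ cs) r ∷ quotient (d ∷ cs) r

  length-quotient : ∀ c cs r → length (quotient (c ∷ cs) r) ≡ length cs
  length-quotient c []       r = refl
  length-quotient c (d ∷ cs) r = cong suc (length-quotient d cs r)

  -- Stated without subtraction: the ring solver has no zero test and cannot cancel x - x.
  evalMonic-quotient : ∀ c cs x r →
    evalMonic (c ∷ cs) x + r * evalMonic (quotient (c ∷ cs) r) x ≡
    x * evalMonic (quotient (c ∷ cs) r) x + evalMonic (c ∷ cs) r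
  evalMonic-quotient c [] x r =
    solve 4 (λ c x r o → (c ⊕ x ⊗ o ⊕ r ⊗ o) ⊜ (x ⊗ o ⊕ (c ⊕ r ⊗ o))) refl c x r 1#
  evalMonic-quotient c (d ∷ cs) x r = begin
    c + x * P x + r * (P r + x * Q)   ≡⟨ solve 6 (λ c x r P P′ Q → (c ⊕ x ⊗ P ⊕ r ⊗ (P′ ⊕ x ⊗ Q))
                                                   ⊜ (c ⊕ r ⊗ P′ ⊕ x ⊗ (P ⊕ r ⊗ Q))) refl c x r (P x) (P r) Q ⟩
    c + r * P r + x * (P x + r * Q)   ≡⟨ cong (λ t → c + r * P r + x * t) (evalMonic-quotient d cs x r) ⟩
    c + r * P r + x * (x * Q + P r)   ≡⟨ solve 5 (λ c x r P′ Q → (c ⊕ r ⊗ P′ ⊕ x ⊗ (x ⊗ Q ⊕ P′))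
                                                   ⊜ (x ⊗ (P′ ⊕ x ⊗ Q) ⊕ (c ⊕ r ⊗ P′))) refl c x r (P r) Q ⟩
    x * (P r + x * Q) + (c + r * P r) ∎
    where
    P : Carrier → Carrier
    P = evalMonic (d ∷ cs)
    Q : Carrier
    Q = evalMonic (quotient (d ∷ cs) r) x

  evalMonic-factor : ∀ c cs {r y} → evalMonic (c ∷ cs) r ≡ 0# → evalMonic (c ∷ cs) y ≡ 0# →
                     r ≡ y ⊎ evalMonic (quotient (c ∷ cs) r) y ≡ 0#
  evalMonic-factor c cs {r} {y} P[r]≡0 P[y]≡0 with evalMonic (quotient (c ∷ cs) r) y ≟ 0#
  ... | yes Q≡0 = inj₂ Q≡0
  ... | no Q≢0  = inj₁ (*-cancelˡ Q≢0 (begin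
    Q * r                        ≡⟨ *-comm Q r ⟩
    r * Q                        ≡⟨ +-identityˡ (r * Q) ⟨
    0# + r * Q                   ≡⟨ cong (_+ r * Q) P[y]≡0 ⟨
    evalMonic (c ∷ cs) y + r * Q ≡⟨ evalMonic-quotient c cs y r ⟩
    y * Q + evalMonic (c ∷ cs) r ≡⟨ cong (y * Q +_) P[r]≡0 ⟩
    y * Q + 0#                   ≡⟨ +-identityʳ (y * Q) ⟩
    y * Q                        ≡⟨ *-comm y Q ⟩
    Q * y                        ∎))
    where
    Q : Carrier
    Q = evalMonic (quotient (c ∷ cs) r) y

  evalMonic-roots : ∀ cs {rs} → Unique rs → All (λ r → evalMonic cs r ≡ 0#) rs → length rs ≤ length cs
  evalMonic-roots cs       {[]}     _ _ = z≤n
  evalMonic-roots []       {r ∷ _}  _ (1≡0 ∷ _) = contradiction 1≡0 1≢0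
  evalMonic-roots (c ∷ cs) {r ∷ rs} (r∉rs ∷ rs!) (P[r]≡0 ∷ P[rs]≡0) =
    subst (λ d → suc (length rs) ≤ suc d) (length-quotient c cs r)
      (s≤s (evalMonic-roots (quotient (c ∷ cs) r) rs! (All.zipWith Q-root (r∉rs , P[rs]≡0))))
    where
    Q-root : ∀ {y} → r ≢ y × evalMonic (c ∷ cs) y ≡ 0# → evalMonic (quotient (c ∷ cs) r) y ≡ 0#
    Q-root (r≢y , P[y]≡0) with evalMonic-factor c cs P[r]≡0 P[y]≡0
    ... | inj₁ r≡y    = contradiction r≡y r≢y
    ... | inj₂ Q[y]≡0 = Q[y]≡0

  ^-roots : ∀ m c {rs} → Unique rs → All (λ x → x ^ suc m ≡ c) rs → length rs ≤ suc m
  ^-roots m c {rs} rs! x^[1+m]≡c = subst (λ d → length rs ≤ suc d) (length-replicate m)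
    (evalMonic-roots (- c ∷ replicate m 0#) rs! (All.map root x^[1+m]≡c))
    where
    evalMonic-replicate-0 : ∀ k x → evalMonic (replicate k 0#) x ≡ x ^ k
    evalMonic-replicate-0 zero    x = refl
    evalMonic-replicate-0 (suc k) x = trans (+-identityˡ _) (cong (x *_) (evalMonic-replicate-0 k x))
    root : ∀ {x} → x ^ suc m ≡ c → evalMonic (- c ∷ replicate m 0#) x ≡ 0#
    root {x} x^[1+m]≡c = begin
      - c + x * evalMonic (replicate m 0#) x ≡⟨ cong (λ t → - c + x * t) (evalMonic-replicate-0 m x) ⟩
      - c + x ^ suc m                        ≡⟨ cong (- c +_) x^[1+m]≡c ⟩
      - c + c                                ≡⟨ -‿inverseˡ c ⟩
      0#                                     ∎

  -- x² + x + 1 = (x - ω)(x + 1 + ω) by synthetic division, and ω² = -(1 + ω).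
  x²+x+1-roots : ∀ {ω x} → ω * ω + ω + 1# ≡ 0# → x * x + x + 1# ≡ 0# → x ≡ ω ⊎ x ≡ ω * ω
  x²+x+1-roots {ω} {x} ω²+ω+1≡0 x²+x+1≡0
    with evalMonic-factor 1# (1# ∷ []) (trans (evalMonic≡ ω) ω²+ω+1≡0) (trans (evalMonic≡ x) x²+x+1≡0)
    where
    evalMonic≡ : ∀ y → evalMonic (1# ∷ 1# ∷ []) y ≡ y * y + y + 1#
    evalMonic≡ y = begin
      1# + y * (1# + y * 1#) ≡⟨ cong (λ t → 1# + y * (1# + t)) (*-identityʳ y) ⟩
      1# + y * (1# + y)      ≡⟨ cong (1# +_) (trans (distribˡ y 1# y) (cong (_+ y * y) (*-identityʳ y))) ⟩
      1# + (y + y * y)       ≡⟨ +-CS.x∙yz≈zy∙x 1# y (y * y) ⟩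
      y * y + y + 1#         ∎
  ... | inj₁ ω≡x          = inj₁ (sym ω≡x)
  ... | inj₂ [1+ω*1]+x*1≡0 = inj₂ (trans (+-inverseʳ-unique (1# + ω) x 1+ω+x≡0)
                                         (sym (+-inverseʳ-unique (1# + ω) (ω * ω) 1+ω+ω²≡0)))
    where
    1+ω+x≡0 : 1# + ω + x ≡ 0#
    1+ω+x≡0 = trans (cong₂ (λ u v → 1# + u + v) (sym (*-identityʳ ω)) (sym (*-identityʳ x))) [1+ω*1]+x*1≡0
    1+ω+ω²≡0 : 1# + ω + ω * ω ≡ 0#
    1+ω+ω²≡0 = trans (+-CS.xy∙z≈yz∙x 1# ω (ω * ω)) (trans (cong (_+ 1#) (+-comm ω (ω * ω))) ω²+ω+1≡0)

  x²+x+1≡0⇒x³≡1 : ∀ {x} → x * x + x + 1# ≡ 0# → x * (x * x) ≡ 1#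
  x²+x+1≡0⇒x³≡1 {x} x²+x+1≡0 = +-cancelʳ (x * x + x) (x * (x * x)) 1# (begin
    x * (x * x) + (x * x + x) ≡⟨ +-assoc _ _ x ⟨
    x * (x * x) + x * x + x   ≡⟨ cong (_+ x) (distribˡ x (x * x) x) ⟨
    x * (x * x + x) + x       ≡⟨ cong (λ t → x * t + x) x²+x≡-1 ⟩
    x * - 1# + x              ≡⟨ cong (_+ x) (trans (sym (-‿distribʳ-* x 1#)) (cong -_ (*-identityʳ x))) ⟩
    - x + x                   ≡⟨ -‿inverseˡ x ⟩
    0#                        ≡⟨ x²+x+1≡0 ⟨
    x * x + x + 1#            ≡⟨ +-comm (x * x + x) 1# ⟩
    1# + (x * x + x)          ∎)
    where
    x²+x≡-1 : x * x + x ≡ - 1#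
    x²+x≡-1 = +-inverseʳ-unique 1# (x * x + x) (trans (+-comm 1# (x * x + x)) x²+x+1≡0)

  x³≡1⇒x≡1⊎x²+x+1≡0 : ∀ {x} → x * (x * x) ≡ 1# → x ≡ 1# ⊎ x * x + x + 1# ≡ 0#
  x³≡1⇒x≡1⊎x²+x+1≡0 {x} x³≡1 with x * x + x + 1# ≟ 0#
  ... | yes x²+x+1≡0 = inj₂ x²+x+1≡0
  ... | no x²+x+1≢0  = inj₁ (*-cancelˡ x²+x+1≢0 (begin
    (x * x + x + 1#) * x     ≡⟨ *-comm _ x ⟩
    x * (x * x + x + 1#)     ≡⟨ distribˡ x (x * x + x) 1# ⟩
    x * (x * x + x) + x * 1# ≡⟨ cong₂ _+_ (distribˡ x (x * x) x) (*-identityʳ x) ⟩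
    x * (x * x) + x * x + x  ≡⟨ cong (λ t → t + x * x + x) x³≡1 ⟩
    1# + x * x + x           ≡⟨ +-CS.xy∙z≈yz∙x 1# (x * x) x ⟩
    x * x + x + 1#           ≡⟨ *-identityʳ _ ⟨
    (x * x + x + 1#) * 1#    ∎))

  x²+x+1≡0⇒[x²]²+x²+1≡0 : ∀ {x} → x * x + x + 1# ≡ 0# → (x * x) * (x * x) + x * x + 1# ≡ 0#
  x²+x+1≡0⇒[x²]²+x²+1≡0 {x} x²+x+1≡0 = begin
    (x * x) * (x * x) + x * x + 1# ≡⟨ cong (λ t → t + x * x + 1#) x⁴≡x ⟩
    x + x * x + 1#                 ≡⟨ cong (_+ 1#) (+-comm x (x * x)) ⟩
    x * x + x + 1#                 ≡⟨ x²+x+1≡0 ⟩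
    0#                             ∎
    where
    x⁴≡x : (x * x) * (x * x) ≡ x
    x⁴≡x = trans (*-assoc x x (x * x)) (trans (cong (x *_) (x²+x+1≡0⇒x³≡1 x²+x+1≡0)) (*-identityʳ x))

  -^-additive : ∀ {N} → 1 ≤ N → (∀ a b → (a + b) ^ N ≡ a ^ N + b ^ N) → ∀ a → (- a) ^ N ≡ - (a ^ N)
  -^-additive {N} 1≤N additive a = +-inverseʳ-unique (a ^ N) ((- a) ^ N) (begin
    a ^ N + (- a) ^ N ≡⟨ additive a (- a) ⟨
    (a + - a) ^ N     ≡⟨ cong (_^ N) (-‿inverseʳ a) ⟩
    0# ^ N            ≡⟨ 0^k≡0 1≤N ⟩
    0#                ∎)

  -- In the binomial expansion of (a + b)^p every middle coefficient p C k is a multiple of p.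
  frobenius : ∀ {p} → Prime p → p · 1# ≡ 0# → ∀ a b → (a + b) ^ p ≡ a ^ p + b ^ p
  frobenius {zero}  0-prime = contradiction 0-prime ¬prime[0]
  frobenius {suc m} p-prime p·1≡0 a b = begin
    (a + b) ^ p                                          ≡⟨ theorem p a b ⟩
    T zero + ∑ (T ∘ suc)                                 ≡⟨ cong (T zero +_) (sum-init-last (T ∘ suc)) ⟩
    T zero + (∑ (T ∘ suc ∘ inject₁) + T (suc (fromℕ m)))
      ≡⟨ cong₂ (λ u v → T zero + (u + v)) middle≡0 last≡a^p ⟩
    T zero + (0# + a ^ p)                                ≡⟨ cong₂ _+_ first≡b^p (+-identityˡ (a ^ p)) ⟩
    b ^ p + a ^ p                                        ≡⟨ +-comm (b ^ p) (a ^ p) ⟩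
    a ^ p + b ^ p                                        ∎
    where
    open import Algebra.Properties.CommutativeSemiring.Binomial (CommutativeRing.commutativeSemiring ring)
      using (theorem; binomialTerm; binomial)
    open import Algebra.Properties.Monoid.Sum (CommutativeRing.+-monoid ring)
      using (sum-init-last; sum-cong-≗; sum-replicate-zero) renaming (sum to ∑)
    p : ℕ
    p = suc m
    T : Fin (suc p) → Carrier
    T = binomialTerm a b p
    first≡b^p : T zero ≡ b ^ p
    first≡b^p = trans (+-identityʳ _) (*-identityˡ _)
    last≡a^p : T (suc (fromℕ m)) ≡ a ^ p
    last≡a^p rewrite toℕ-fromℕ m | nCn≡1 p | ℕ.n∸n≡0 m = trans (+-identityʳ _) (*-identityʳ _)
    middle≡0 : ∑ (T ∘ suc ∘ inject₁) ≡ 0#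
    middle≡0 = trans (sum-cong-≗ term≡0) (sum-replicate-zero m)
      where
      term≡0 : ∀ i → T (suc (inject₁ i)) ≡ 0#
      term≡0 i with prime∣pCk p-prime (s≤s z≤n) (s≤s (subst (ℕ._< m) (sym (toℕ-inject₁ i)) (toℕ<n i)))
      ... | divides d pCk≡d*p = begin
        (p C k) · B             ≡⟨ ·≡·1* (p C k) B ⟩
        ((p C k) · 1#) * B      ≡⟨ cong (λ j → (j · 1#) * B) pCk≡d*p ⟩
        ((d ℕ.* p) · 1#) * B    ≡⟨ cong (_* B) (×1-homo-* d p) ⟩
        (d · 1#) * (p · 1#) * B ≡⟨ cong (λ t → (d · 1#) * t * B) p·1≡0 ⟩
        (d · 1#) * 0# * B       ≡⟨ cong (_* B) (zeroʳ (d · 1#)) ⟩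
        0# * B                  ≡⟨ zeroˡ B ⟩
        0#                      ∎
        where
        k : ℕ
        k = suc (toℕ (inject₁ i))
        B : Carrier
        B = binomial a b p (suc (inject₁ i))

  frobenius-^ : ∀ {p} → Prime p → p · 1# ≡ 0# →
                ∀ k a b → (a + b) ^ (p ℕ.^ k) ≡ a ^ (p ℕ.^ k) + b ^ (p ℕ.^ k)
  frobenius-^ _ _ zero a b = trans (*-identityʳ (a + b)) (sym (cong₂ _+_ (*-identityʳ a) (*-identityʳ b)))
  frobenius-^ {p} p-prime p·1≡0 (suc k) a b = begin
    (a + b) ^ (p ℕ.* p ℕ.^ k)                 ≡⟨ ^-assocʳ (a + b) p (p ℕ.^ k) ⟨
    ((a + b) ^ p) ^ (p ℕ.^ k)                 ≡⟨ cong (_^ (p ℕ.^ k)) (frobenius p-prime p·1≡0 a b) ⟩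
    (a ^ p + b ^ p) ^ (p ℕ.^ k)               ≡⟨ frobenius-^ p-prime p·1≡0 k (a ^ p) (b ^ p) ⟩
    (a ^ p) ^ (p ℕ.^ k) + (b ^ p) ^ (p ℕ.^ k) ≡⟨ cong₂ _+_ (^-assocʳ a p (p ℕ.^ k)) (^-assocʳ b p (p ℕ.^ k)) ⟩
    a ^ (p ℕ.* p ℕ.^ k) + b ^ (p ℕ.* p ℕ.^ k) ∎

  elements : List Carrier
  elements = allFin n

  length-elements : length elements ≡ n
  length-elements = length-tabulate id

  nonzero : List Carrier
  nonzero = filter (λ x → ¬? (x ≟ 0#)) elements

  nonzero! : Unique nonzero
  nonzero! = Unique.filter⁺ (λ x → ¬? (x ≟ 0#)) (Unique.allFin⁺ n)

  ∈-nonzero⁺ : ∀ {x} → x ≢ 0# → x ∈ nonzero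
  ∈-nonzero⁺ = ∈-filter⁺ (λ x → ¬? (x ≟ 0#)) (∈-allFin _)

  ∈-nonzero⁻ : ∀ {x} → x ∈ nonzero → x ≢ 0#
  ∈-nonzero⁻ x∈ = proj₂ (∈-filter⁻ (λ x → ¬? (x ≟ 0#)) {xs = elements} x∈)

  elements↭0∷nonzero : elements ↭ 0# ∷ nonzero
  elements↭0∷nonzero = ∼bag⇒↭ (unique∧set⇒bag (Unique.allFin⁺ n) 0∷nonzero! (mk⇔ split (λ _ → ∈-allFin _)))
    where
    0∷nonzero! : Unique (0# ∷ nonzero)
    0∷nonzero! = All.tabulate (λ x∈ → ∈-nonzero⁻ x∈ ∘ sym) ∷ nonzero!
    split : ∀ {x} → x ∈ elements → x ∈ 0# ∷ nonzero
    split {x} _ with x ≟ 0#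
    ... | yes refl = here refl
    ... | no x≢0   = there (∈-nonzero⁺ x≢0)

  length-nonzero : length nonzero ≡ n ∸ 1
  length-nonzero = cong (_∸ 1) (trans (sym (↭-length elements↭0∷nonzero)) length-elements)

  -- x^t = 1 has at most t roots, fewer than there are units.
  ∃-nonzero-x^t≢1 : ∀ {t} → 1 ≤ t → t < n ∸ 1 → Σ Carrier (λ x → x ∈ nonzero × x ^ t ≢ 1#)
  ∃-nonzero-x^t≢1 {t} 1≤t t<n∸1 with All.all? (λ x → x ^ t ≟ 1#) nonzero
  ... | no ¬x^t≡1 = find (All.¬All⇒Any¬ (λ x → x ^ t ≟ 1#) nonzero ¬x^t≡1)
  ... | yes x^t≡1 = contradiction
    (^-roots (t ∸ 1) 1# nonzero! (subst (λ m → All (λ x → x ^ m ≡ 1#) nonzero) t≡1+[t∸1] x^t≡1))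
    (ℕ.<⇒≱ (subst₂ ℕ._<_ t≡1+[t∸1] (sym length-nonzero) t<n∸1))
    where
    t≡1+[t∸1] : t ≡ suc (t ∸ 1)
    t≡1+[t∸1] = sym (ℕ.m+[n∸m]≡n 1≤t)

  private
    product : List Carrier → Carrier
    product = foldr _*_ 1#

    product-↭ : ∀ {xs ys} → xs ↭ ys → product xs ≡ product ys
    product-↭ xs↭ys = foldr-commMonoid (setoid Carrier) (CommutativeRing.*-isCommutativeMonoid ring) (↭⇒↭ₛ xs↭ys)

    product-map-*ˡ : ∀ x xs → product (map (x *_) xs) ≡ x ^ length xs * product xs
    product-map-*ˡ x []       = sym (*-identityˡ 1#)
    product-map-*ˡ x (y ∷ xs) =
      trans (cong (x * y *_) (product-map-*ˡ x xs)) (*-CS.interchange x y (x ^ length xs) (product xs))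

    product-≢0 : ∀ {xs} → (∀ {x} → x ∈ xs → x ≢ 0#) → product xs ≢ 0#
    product-≢0 {[]}     _   = 1≢0
    product-≢0 {x ∷ xs} ≢0 = *-≢0 (≢0 (here refl)) (product-≢0 (≢0 ∘ there))

    sum : List Carrier → Carrier
    sum = foldr _+_ 0#

    sum-↭ : ∀ {xs ys} → xs ↭ ys → sum xs ≡ sum ys
    sum-↭ xs↭ys = foldr-commMonoid (setoid Carrier) (CommutativeRing.+-isCommutativeMonoid ring) (↭⇒↭ₛ xs↭ys)

    sum-map-+1 : ∀ xs → sum (map (_+ 1#) xs) ≡ sum xs + length xs · 1#
    sum-map-+1 []       = sym (+-identityˡ 0#)
    sum-map-+1 (x ∷ xs) = trans (cong (x + 1# +_) (sum-map-+1 xs)) (+-CS.interchange x 1# (sum xs) (length xs · 1#))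

  -- Multiplication by x permutes the nonzero elements, which fixes their product.
  fermat : ∀ {x} → x ≢ 0# → x ^ (n ∸ 1) ≡ 1#
  fermat {x} x≢0 = subst (λ k → x ^ k ≡ 1#) length-nonzero
    (*-cancelˡ (product-≢0 ∈-nonzero⁻) (begin
      product nonzero * x ^ length nonzero ≡⟨ *-comm _ _ ⟩
      x ^ length nonzero * product nonzero ≡⟨ product-map-*ˡ x nonzero ⟨
      product (map (x *_) nonzero)         ≡⟨ product-↭ x*-permutes ⟩
      product nonzero                      ≡⟨ *-identityʳ _ ⟨
      product nonzero * 1#                 ∎))
    where
    x*-permutes : map (x *_) nonzero ↭ nonzero
    x*-permutes = map-↭ nonzero! (*-cancelˡ x≢0) (λ y∈ → ∈-nonzero⁺ (*-≢0 x≢0 (∈-nonzero⁻ y∈))) preimage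
      where
      preimage : ∀ {y} → y ∈ nonzero → ∃[ z ] z ∈ nonzero × x * z ≡ y
      preimage {y} y∈ with inverse x x≢0
      ... | x⁻¹ , x*x⁻¹≡1 = x⁻¹ * y , ∈-nonzero⁺ x⁻¹*y≢0 , x*[x⁻¹*y]≡y
        where
        x*[x⁻¹*y]≡y : x * (x⁻¹ * y) ≡ y
        x*[x⁻¹*y]≡y = trans (sym (*-assoc x x⁻¹ y)) (trans (cong (_* y) x*x⁻¹≡1) (*-identityˡ y))
        x⁻¹*y≢0 : x⁻¹ * y ≢ 0#
        x⁻¹*y≢0 x⁻¹*y≡0 =
          ∈-nonzero⁻ y∈ (trans (sym x*[x⁻¹*y]≡y) (trans (cong (x *_) x⁻¹*y≡0) (zeroʳ x)))

  -- Adding 1 permutes the elements, which fixes their sum.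
  characteristic : n · 1# ≡ 0#
  characteristic = +-identityʳ-unique (sum elements) (n · 1#) (begin
    sum elements + n · 1#               ≡⟨ cong (λ k → sum elements + k · 1#) length-elements ⟨
    sum elements + length elements · 1# ≡⟨ sum-map-+1 elements ⟨
    sum (map (_+ 1#) elements)          ≡⟨ sum-↭ +1-permutes ⟩
    sum elements                        ∎)
    where
    y-1+1≡y : ∀ y → y + - 1# + 1# ≡ y
    y-1+1≡y y = trans (+-assoc y (- 1#) 1#) (trans (cong (y +_) (-‿inverseˡ 1#)) (+-identityʳ y))
    +1-permutes : map (_+ 1#) elements ↭ elements
    +1-permutes = map-↭ (Unique.allFin⁺ n) (+-cancelʳ 1# _ _) (λ _ → ∈-allFin _)
      (λ {y} _ → y + - 1# , ∈-allFin _ , y-1+1≡y y)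

module FermatCurve {n : ℕ} (F : FiniteField n) (e : ℕ) (1≤e : 1 ≤ e) where

  open Counting
  open FieldProperties F
  import Data.Nat as ℕ
  import Data.Nat.Properties as ℕ
  open import Data.Nat.ListAction using (sum)
  import Data.Nat.ListAction.Properties as ℕ
  open import Data.Fin using (_≟_)
  open import Data.List using (List; []; _∷_; _++_; map; concatMap)
  import Data.List.Relation.Unary.All as All
  open import Data.List.Relation.Unary.Any using (here)
  import Data.List.Relation.Binary.Permutation.Propositional.Properties as ↭
  open import Data.Product using (_×_; _,_)
  open import Function using (_⇔_; mk⇔)
  open import Relation.Unary using (Decidable)
  open import Relation.Binary.PropositionalEquality
  open ≡-Reasoning

  solutions : Carrier → ℕ
  solutions s = count (λ w → s + w ^ e ≟ 0#) elements

  sum-elements : (f : Carrier → ℕ) → sum (map f elements) ≡ f 0# ℕ.+ sum (map f nonzero)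
  sum-elements f = ℕ.sum-↭ (↭.map⁺ f elements↭0∷nonzero)

  curvePointCount≡ : curvePointCount e ≡ sum (map (λ v → solutions (1# + v ^ e)) elements) ℕ.+ solutions 1#
  curvePointCount≡ = begin
    curvePointCount e
      ≡⟨ count-cong _ onCurve? projPoints (λ {t} _ → pow⇔^ t) ⟩
    count onCurve? (affine ++ lineAtInfinity ++ (0# , 0# , 1#) ∷ [])
      ≡⟨ count-++ onCurve? affine (lineAtInfinity ++ (0# , 0# , 1#) ∷ []) ⟩
    count onCurve? affine ℕ.+ count onCurve? (lineAtInfinity ++ (0# , 0# , 1#) ∷ [])
      ≡⟨ cong (count onCurve? affine ℕ.+_) (count-++ onCurve? lineAtInfinity ((0# , 0# , 1#) ∷ [])) ⟩
    count onCurve? affine ℕ.+ (count onCurve? lineAtInfinity ℕ.+ count onCurve? ((0# , 0# , 1#) ∷ []))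
      ≡⟨ cong₂ (λ a b → a ℕ.+ (b ℕ.+ count onCurve? ((0# , 0# , 1#) ∷ []))) affine≡ lineAtInfinity≡ ⟩
    sum (map (λ v → solutions (1# + v ^ e)) elements) ℕ.+ (solutions 1# ℕ.+ count onCurve? ((0# , 0# , 1#) ∷ []))
      ≡⟨ cong (λ c → sum (map (λ v → solutions (1# + v ^ e)) elements) ℕ.+ (solutions 1# ℕ.+ c)) [0:0:1]∉curve ⟩
    sum (map (λ v → solutions (1# + v ^ e)) elements) ℕ.+ (solutions 1# ℕ.+ 0)
      ≡⟨ cong (sum (map (λ v → solutions (1# + v ^ e)) elements) ℕ.+_) (ℕ.+-identityʳ (solutions 1#)) ⟩
    sum (map (λ v → solutions (1# + v ^ e)) elements) ℕ.+ solutions 1# ∎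
    where
    OnCurve : Carrier × Carrier × Carrier → Set
    OnCurve (u , v , w) = u ^ e + v ^ e + w ^ e ≡ 0#
    onCurve? : Decidable OnCurve
    onCurve? (u , v , w) = u ^ e + v ^ e + w ^ e ≟ 0#
    OnCurveᵖᵒʷ : Carrier × Carrier × Carrier → Set
    OnCurveᵖᵒʷ (u , v , w) = pow u e + pow v e + pow w e ≡ 0#
    pow⇔^ : ∀ t → OnCurveᵖᵒʷ t ⇔ OnCurve t
    pow⇔^ (u , v , w) = mk⇔ (subst (_≡ 0#) pow≡^) (subst (_≡ 0#) (sym pow≡^))
      where
      pow≡^ : pow u e + pow v e + pow w e ≡ u ^ e + v ^ e + w ^ e
      pow≡^ = cong₂ _+_ (cong₂ _+_ (pow≗^ u e) (pow≗^ v e)) (pow≗^ w e)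
    affine lineAtInfinity : List (Carrier × Carrier × Carrier)
    affine = concatMap (λ v → map (λ w → (1# , v , w)) elements) elements
    lineAtInfinity = map (λ w → (0# , 1# , w)) elements
    affine≡ : count onCurve? affine ≡ sum (map (λ v → solutions (1# + v ^ e)) elements)
    affine≡ = trans (count-concatMap onCurve? _ elements) (sum-map-cong elements (λ {v} _ →
      trans (count-map onCurve? _ elements) (cong (λ s → solutions (s + v ^ e)) (1^k≡1 e))))
    lineAtInfinity≡ : count onCurve? lineAtInfinity ≡ solutions 1#
    lineAtInfinity≡ = trans (count-map onCurve? _ elements)
      (cong solutions (trans (cong₂ _+_ (0^k≡0 1≤e) (1^k≡1 e)) (+-identityˡ 1#)))
    0+0+1≡1 : 0# ^ e + 0# ^ e + 1# ^ e ≡ 1#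
    0+0+1≡1 = trans (cong₂ _+_ (cong₂ _+_ (0^k≡0 1≤e) (0^k≡0 1≤e)) (1^k≡1 e))
                    (trans (cong (_+ 1#) (+-identityˡ 0#)) (+-identityˡ 1#))
    [0:0:1]∉curve : count onCurve? ((0# , 0# , 1#) ∷ []) ≡ 0
    [0:0:1]∉curve = count-none onCurve? {(0# , 0# , 1#) ∷ []}
      (All.tabulate λ { (here refl) 0+0+1≡0 → 1≢0 (trans (sym 0+0+1≡1) 0+0+1≡0) })

module FermatCurveOverFq² (p r : ℕ) (p-prime : Prime p) (1≤r : 1 ≤ r) (F : FiniteField ((p ℕ.^ r) ℕ.^ 2)) where

  open Counting
  open NatLemmas
  open FieldProperties F
  open import Data.Nat as ℕ using (suc; _∸_; _<_; z≤n; s≤s)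
  import Data.Nat.Properties as ℕ
  open import Data.Nat.ListAction using (sum)
  open import Data.Nat.DivMod using (_%_; _/_; m≡m%n+[m/n]*n)
  open import Data.Nat.Divisibility using (_∣_; divides)
  open import Data.Nat.Primality using (prime⇒nonZero; prime⇒irreducible)
  open import Data.Fin using (_≟_)
  open import Data.List using (List; []; _∷_; map; filter; length)
  open import Data.List.Relation.Unary.All as All using (All)
  import Data.List.Relation.Unary.All.Properties as All
  open import Data.List.Relation.Unary.Unique.Propositional using (Unique)
  import Data.List.Relation.Unary.Unique.Propositional.Properties as Unique
  open import Data.List.Membership.Propositional using (_∈_)
  open import Data.List.Membership.Propositional.Properties using (∈-filter⁺; ∈-filter⁻; ∈-allFin)
  open import Data.Product using (Σ; _×_; _,_; proj₁; proj₂)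
  open import Data.Sum using (_⊎_; inj₁; inj₂)
  open import Function using (_∘_; _⇔_; mk⇔)
  open import Relation.Nullary using (Dec; yes; no; contradiction)
  open import Relation.Unary.Properties using (_∪?_)
  open import Relation.Binary.PropositionalEquality
  open ≡-Reasoning

  q e : ℕ
  q = p ℕ.^ r
  e = q ∸ 1

  2≤q : 2 ≤ q
  2≤q = ℕ.≤-trans (prime⇒≥2 p-prime)
    (subst (_≤ q) (ℕ.*-identityʳ p) (ℕ.^-monoʳ-≤ p {{prime⇒nonZero p-prime}} 1≤r))

  q≡1+e : q ≡ suc e
  q≡1+e = sym (ℕ.m+[n∸m]≡n (ℕ.≤-trans (s≤s z≤n) 2≤q))

  1≤e : 1 ≤ e
  1≤e = ℕ.≤-pred (subst (2 ≤_) q≡1+e 2≤q)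

  e≡1+[e∸1] : e ≡ suc (e ∸ 1)
  e≡1+[e∸1] = sym (ℕ.m+[n∸m]≡n 1≤e)

  q²∸1≡e*[1+q] : q ℕ.^ 2 ∸ 1 ≡ e ℕ.* suc q
  q²∸1≡e*[1+q] = begin
    q ℕ.^ 2 ∸ 1                     ≡⟨ cong (λ t → t ℕ.^ 2 ∸ 1) q≡1+e ⟩
    suc e ℕ.^ 2 ∸ 1                 ≡⟨ [1+m]²∸1≡m*[2+m] e ⟩
    e ℕ.* suc (suc e)               ≡⟨ cong (λ t → e ℕ.* suc t) q≡1+e ⟨
    e ℕ.* suc q                     ∎

  q·1≡0 : q · 1# ≡ 0#
  q·1≡0 = x^k≡0⇒x≡0 2 (trans (sym (·1-homo-^ q 2)) characteristic)

  p·1≡0 : p · 1# ≡ 0#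
  p·1≡0 = x^k≡0⇒x≡0 r (trans (sym (·1-homo-^ p r)) q·1≡0)

  frobenius-q : ∀ a b → (a + b) ^ q ≡ a ^ q + b ^ q
  frobenius-q = frobenius-^ p-prime p·1≡0 r

  -^q : ∀ a → (- a) ^ q ≡ - (a ^ q)
  -^q = -^-additive (ℕ.≤-trans (s≤s z≤n) 2≤q) frobenius-q

  μ? : ∀ c → Dec (c ^ suc q ≡ 1#)
  μ? c = c ^ suc q ≟ 1#

  μ : List Carrier
  μ = filter μ? elements

  μ! : Unique μ
  μ! = Unique.filter⁺ μ? (Unique.allFin⁺ _)

  ∈-μ⁺ : ∀ {c} → c ^ suc q ≡ 1# → c ∈ μ
  ∈-μ⁺ = ∈-filter⁺ μ? (∈-allFin _)

  ∈-μ⁻ : ∀ {c} → c ∈ μ → c ^ suc q ≡ 1#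
  ∈-μ⁻ c∈μ = proj₂ (∈-filter⁻ μ? {xs = elements} c∈μ)

  length-μ≤1+q : length μ ≤ suc q
  length-μ≤1+q = ^-roots q 1# μ! (All.all-filter μ? elements)

  ^e∈μ : ∀ {x} → x ∈ nonzero → x ^ e ∈ μ
  ^e∈μ {x} x∈ = ∈-μ⁺ (begin
    (x ^ e) ^ suc q     ≡⟨ ^-assocʳ x e (suc q) ⟩
    x ^ (e ℕ.* suc q)   ≡⟨ cong (x ^_) q²∸1≡e*[1+q] ⟨
    x ^ (q ℕ.^ 2 ∸ 1)   ≡⟨ fermat (∈-nonzero⁻ x∈) ⟩
    1#                  ∎)

  fibre : Carrier → ℕ
  fibre c = count (λ x → c ≟ x ^ e) nonzero

  fibre≤e : ∀ c → fibre c ≤ e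
  fibre≤e c = subst (fibre c ≤_) (sym e≡1+[e∸1])
    (^-roots (e ∸ 1) c (Unique.filter⁺ (λ x → c ≟ x ^ e) nonzero!)
      (All.map x^[1+[e∸1]]≡c (All.all-filter (λ x → c ≟ x ^ e) nonzero)))
    where
    x^[1+[e∸1]]≡c : ∀ {x} → c ≡ x ^ e → x ^ suc (e ∸ 1) ≡ c
    x^[1+[e∸1]]≡c {x} c≡x^e = subst (λ k → x ^ k ≡ c) e≡1+[e∸1] (sym c≡x^e)

  sum-fibre : sum (map fibre μ) ≡ e ℕ.* suc q
  sum-fibre = begin
    sum (map fibre μ)                        ≡⟨ sum-map-cong μ (λ _ → sym (ℕ.*-identityʳ _)) ⟩
    sum (map (λ c → fibre c ℕ.* 1) μ)        ≡⟨ sum-map-fibres _≟_ (_^ e) (λ _ → 1) nonzero μ! ^e∈μ ⟨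
    sum (map (λ _ → 1) nonzero)              ≡⟨ sum-map-const-1 nonzero ⟩
    length nonzero                           ≡⟨ length-nonzero ⟩
    q ℕ.^ 2 ∸ 1                              ≡⟨ q²∸1≡e*[1+q] ⟩
    e ℕ.* suc q                              ∎
    where
    sum-map-const-1 : ∀ xs → sum (map (λ (_ : Carrier) → 1) xs) ≡ length xs
    sum-map-const-1 []       = refl
    sum-map-const-1 (_ ∷ xs) = cong suc (sum-map-const-1 xs)

  -- Each fibre has at most e elements, and the fibres over μ together exhaust the e (q + 1) units.
  fibre≡e : ∀ {c} → c ∈ μ → fibre c ≡ e
  fibre≡e = sum-map-saturated μ (λ {c} _ → fibre≤e c) length-μ≤1+q sum-fibre

  fibre≡e*[c∈μ] : ∀ c → fibre c ≡ e ℕ.* indicator (μ? c)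
  fibre≡e*[c∈μ] c with μ? c
  ... | yes c∈μ = trans (fibre≡e (∈-μ⁺ c∈μ)) (sym (ℕ.*-identityʳ e))
  ... | no c∉μ  = trans (count-none (λ x → c ≟ x ^ e) (All.tabulate c≢x^e)) (sym (ℕ.*-zeroʳ e))
    where
    c≢x^e : ∀ {x} → x ∈ nonzero → c ≢ x ^ e
    c≢x^e x∈ c≡x^e = c∉μ (∈-μ⁻ (subst (_∈ μ) (sym c≡x^e) (^e∈μ x∈)))

  open FermatCurve F e 1≤e

  solutions≡ : ∀ s → solutions s ≡ indicator (s ≟ 0#) ℕ.+ e ℕ.* indicator (μ? (- s))
  solutions≡ s = begin
    solutions s
      ≡⟨ count-↭ (λ w → s + w ^ e ≟ 0#) elements↭0∷nonzero ⟩
    count (λ w → s + w ^ e ≟ 0#) (0# ∷ nonzero)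
      ≡⟨ count-∷ (λ w → s + w ^ e ≟ 0#) 0# nonzero ⟩
    indicator (s + 0# ^ e ≟ 0#) ℕ.+ count (λ w → s + w ^ e ≟ 0#) nonzero
      ≡⟨ cong₂ ℕ._+_ (indicator-cong (s + 0# ^ e ≟ 0#) (s ≟ 0#) (mk⇔ (trans (sym s+0≡s)) (trans s+0≡s)))
                     (count-cong _ (λ x → - s ≟ x ^ e) nonzero
                       (λ _ → mk⇔ (sym ∘ +-inverseʳ-unique s _) -s≡w^e⇒s+w^e≡0)) ⟩
    indicator (s ≟ 0#) ℕ.+ fibre (- s)
      ≡⟨ cong (indicator (s ≟ 0#) ℕ.+_) (fibre≡e*[c∈μ] (- s)) ⟩
    indicator (s ≟ 0#) ℕ.+ e ℕ.* indicator (μ? (- s)) ∎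
    where
    s+0≡s : s + 0# ^ e ≡ s
    s+0≡s = trans (cong (s +_) (0^k≡0 1≤e)) (+-identityʳ s)
    -s≡w^e⇒s+w^e≡0 : ∀ {w} → - s ≡ w ^ e → s + w ^ e ≡ 0#
    -s≡w^e⇒s+w^e≡0 -s≡w^e = trans (cong (s +_) (sym -s≡w^e)) (-‿inverseʳ s)

  -x∈μ : ∀ {x} → x ∈ μ → - x ∈ μ
  -x∈μ {x} x∈μ = ∈-μ⁺ (trans (cong (- x *_) (-^q x)) (trans (-x*-y≡x*y x (x ^ q)) (∈-μ⁻ x∈μ)))

  1∈μ : 1# ∈ μ
  1∈μ = ∈-μ⁺ (1^k≡1 (suc q))

  S : ℕ
  S = count (λ c → μ? (- (1# + c))) μ

  solutions-1≡e : solutions 1# ≡ e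
  solutions-1≡e = begin
    solutions 1#                                        ≡⟨ solutions≡ 1# ⟩
    indicator (1# ≟ 0#) ℕ.+ e ℕ.* indicator (μ? (- 1#)) ≡⟨ cong₂ ℕ._+_ (indicator-no (1# ≟ 0#) 1≢0)
                                                            (cong (e ℕ.*_) (indicator-yes (μ? (- 1#)) (∈-μ⁻ (-x∈μ 1∈μ)))) ⟩
    e ℕ.* 1                                             ≡⟨ ℕ.*-identityʳ e ⟩
    e                                                   ∎

  count-[1+c≡0]≡1 : count (λ c → 1# + c ≟ 0#) μ ≡ 1
  count-[1+c≡0]≡1 = trans (count-cong _ (_≟ - 1#) μ (λ _ → mk⇔ (+-inverseʳ-unique 1# _) 1+c≡0))
                          (count-≡-unique _≟_ μ! (-x∈μ 1∈μ))
    where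
    1+c≡0 : ∀ {c} → c ≡ - 1# → 1# + c ≡ 0#
    1+c≡0 c≡-1 = trans (cong (1# +_) c≡-1) (-‿inverseʳ 1#)

  sum-solutions-μ : sum (map (λ c → solutions (1# + c)) μ) ≡ 1 ℕ.+ e ℕ.* S
  sum-solutions-μ = begin
    sum (map (λ c → solutions (1# + c)) μ)
      ≡⟨ sum-map-cong μ (λ {c} _ → solutions≡ (1# + c)) ⟩
    sum (map (λ c → indicator (1# + c ≟ 0#) ℕ.+ e ℕ.* indicator (μ? (- (1# + c)))) μ)
      ≡⟨ sum-map-+ _ _ μ ⟩
    sum (map (λ c → indicator (1# + c ≟ 0#)) μ) ℕ.+ sum (map (λ c → e ℕ.* indicator (μ? (- (1# + c)))) μ)
      ≡⟨ cong₂ ℕ._+_ (sym (count≡sum-indicator (λ c → 1# + c ≟ 0#) μ)) (sum-map-*ˡ e _ μ) ⟩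
    count (λ c → 1# + c ≟ 0#) μ ℕ.+ e ℕ.* sum (map (λ c → indicator (μ? (- (1# + c)))) μ)
      ≡⟨ cong₂ ℕ._+_ count-[1+c≡0]≡1 (cong (e ℕ.*_) (sym (count≡sum-indicator (λ c → μ? (- (1# + c))) μ))) ⟩
    1 ℕ.+ e ℕ.* S ∎

  sum-solutions-nonzero : sum (map (λ v → solutions (1# + v ^ e)) nonzero) ≡ e ℕ.* (1 ℕ.+ e ℕ.* S)
  sum-solutions-nonzero = begin
    sum (map (λ v → solutions (1# + v ^ e)) nonzero)    ≡⟨ sum-map-fibres _≟_ (_^ e) (λ c → solutions (1# + c)) nonzero μ! ^e∈μ ⟩
    sum (map (λ c → fibre c ℕ.* solutions (1# + c)) μ) ≡⟨ sum-map-cong μ (λ {c} c∈μ → cong (ℕ._* solutions (1# + c)) (fibre≡e c∈μ)) ⟩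
    sum (map (λ c → e ℕ.* solutions (1# + c)) μ)       ≡⟨ sum-map-*ˡ e _ μ ⟩
    e ℕ.* sum (map (λ c → solutions (1# + c)) μ)       ≡⟨ cong (e ℕ.*_) sum-solutions-μ ⟩
    e ℕ.* (1 ℕ.+ e ℕ.* S)                              ∎

  curvePointCount≡3e+Se² : curvePointCount e ≡ 3 ℕ.* e ℕ.+ S ℕ.* e ℕ.^ 2
  curvePointCount≡3e+Se² = begin
    curvePointCount e
      ≡⟨ curvePointCount≡ ⟩
    sum (map (λ v → solutions (1# + v ^ e)) elements) ℕ.+ solutions 1#
      ≡⟨ cong (ℕ._+ solutions 1#) (sum-elements _) ⟩
    solutions (1# + 0# ^ e) ℕ.+ sum (map (λ v → solutions (1# + v ^ e)) nonzero) ℕ.+ solutions 1#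
      ≡⟨ cong₂ (λ a b → a ℕ.+ b ℕ.+ solutions 1#) (cong solutions 1+0^e≡1) sum-solutions-nonzero ⟩
    solutions 1# ℕ.+ e ℕ.* (1 ℕ.+ e ℕ.* S) ℕ.+ solutions 1#
      ≡⟨ cong (λ a → a ℕ.+ e ℕ.* (1 ℕ.+ e ℕ.* S) ℕ.+ a) solutions-1≡e ⟩
    e ℕ.+ e ℕ.* (1 ℕ.+ e ℕ.* S) ℕ.+ e
      ≡⟨ m+m*[1+m*s]+m≡3m+s*m² e S ⟩
    3 ℕ.* e ℕ.+ S ℕ.* e ℕ.^ 2 ∎
    where
    1+0^e≡1 : 1# + 0# ^ e ≡ 1#
    1+0^e≡1 = trans (cong (1# +_) (0^k≡0 1≤e)) (+-identityʳ 1#)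

  -- For c ∈ μ, c^q = c⁻¹, so (1 + c)^(q + 1) = (1 + c)(1 + c⁻¹).
  -[1+c]∈μ⇔c²+c+1≡0 : ∀ {c} → c ∈ μ → (- (1# + c)) ^ suc q ≡ 1# ⇔ c * c + c + 1# ≡ 0#
  -[1+c]∈μ⇔c²+c+1≡0 {c} c∈μ = mk⇔ to from
    where
    A : Carrier
    A = c ^ q
    c*A≡1 : c * A ≡ 1#
    c*A≡1 = ∈-μ⁻ c∈μ
    X : Carrier
    X = 1# + c + A
    -[1+c]^[1+q]≡1+X : (- (1# + c)) ^ suc q ≡ 1# + X
    -[1+c]^[1+q]≡1+X = begin
      - (1# + c) * (- (1# + c)) ^ q     ≡⟨ cong (- (1# + c) *_) (-^q (1# + c)) ⟩
      - (1# + c) * - ((1# + c) ^ q)     ≡⟨ -x*-y≡x*y (1# + c) _ ⟩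
      (1# + c) * (1# + c) ^ q           ≡⟨ cong ((1# + c) *_) (trans (frobenius-q 1# c) (cong (_+ A) (1^k≡1 q))) ⟩
      (1# + c) * (1# + A)               ≡⟨ distribˡ (1# + c) 1# A ⟩
      (1# + c) * 1# + (1# + c) * A      ≡⟨ cong₂ _+_ (*-identityʳ _) (distribʳ A 1# c) ⟩
      (1# + c) + (1# * A + c * A)       ≡⟨ cong₂ (λ u v → (1# + c) + (u + v)) (*-identityˡ A) c*A≡1 ⟩
      (1# + c) + (A + 1#)               ≡⟨ cong ((1# + c) +_) (+-comm A 1#) ⟩
      (1# + c) + (1# + A)               ≡⟨ +-CS.x∙yz≈y∙xz (1# + c) 1# A ⟩
      1# + X                            ∎
    c*X≡c²+c+1 : c * X ≡ c * c + c + 1#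
    c*X≡c²+c+1 = begin
      c * (1# + c + A)           ≡⟨ distribˡ c (1# + c) A ⟩
      c * (1# + c) + c * A       ≡⟨ cong₂ _+_ (trans (distribˡ c 1# c) (cong (_+ c * c) (*-identityʳ c))) c*A≡1 ⟩
      c + c * c + 1#             ≡⟨ cong (_+ 1#) (+-comm c (c * c)) ⟩
      c * c + c + 1#             ∎
    X≡0 : c * c + c + 1# ≡ 0# → X ≡ 0#
    X≡0 c²+c+1≡0 with x*y≡0⇒x≡0⊎y≡0 (trans c*X≡c²+c+1 c²+c+1≡0)
    ... | inj₁ c≡0 = contradiction (trans (sym c*A≡1) (trans (cong (_* A) c≡0) (zeroˡ A))) 1≢0
    ... | inj₂ X≡0 = X≡0
    to : (- (1# + c)) ^ suc q ≡ 1# → c * c + c + 1# ≡ 0#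
    to -[1+c]^[1+q]≡1 = begin
      c * c + c + 1# ≡⟨ c*X≡c²+c+1 ⟨
      c * X          ≡⟨ cong (c *_) (+-identityʳ-unique 1# X (trans (sym -[1+c]^[1+q]≡1+X) -[1+c]^[1+q]≡1)) ⟩
      c * 0#         ≡⟨ zeroʳ c ⟩
      0#             ∎
    from : c * c + c + 1# ≡ 0# → (- (1# + c)) ^ suc q ≡ 1#
    from c²+c+1≡0 = trans -[1+c]^[1+q]≡1+X (trans (cong (1# +_) (X≡0 c²+c+1≡0)) (+-identityʳ 1#))

  S≡count-x²+x+1 : S ≡ count (λ c → c * c + c + 1# ≟ 0#) μ
  S≡count-x²+x+1 = count-cong _ _ μ -[1+c]∈μ⇔c²+c+1≡0

  q≡q%3+[q/3]*3 : q ≡ q % 3 ℕ.+ (q / 3) ℕ.* 3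
  q≡q%3+[q/3]*3 = m≡m%n+[m/n]*n q 3

  S≡0 : q % 3 ≡ 1 → S ≡ 0
  S≡0 q%3≡1 = trans S≡count-x²+x+1 (count-none _ (All.tabulate no-root))
    where
    k : ℕ
    k = q / 3
    q≡1+k*3 : q ≡ suc (k ℕ.* 3)
    q≡1+k*3 = trans q≡q%3+[q/3]*3 (cong (ℕ._+ k ℕ.* 3) q%3≡1)
    -- A root c of x² + x + 1 in μ has c³ = 1 = c^(3k+2), forcing c = 1 and hence 3 = 0; but q = 3k + 1.
    no-root : ∀ {c} → c ∈ μ → c * c + c + 1# ≢ 0#
    no-root {c} c∈μ c²+c+1≡0 = 1≢0 (begin
      1#                               ≡⟨ +-identityʳ 1# ⟨
      1# + 0#                          ≡⟨ cong (1# +_) (zeroʳ (k · 1#)) ⟨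
      1# + (k · 1#) * 0#               ≡⟨ cong (λ t → 1# + (k · 1#) * t) 3·1≡0 ⟨
      1# + (k · 1#) * (3 · 1#)         ≡⟨ cong (1# +_) (×1-homo-* k 3) ⟨
      suc (k ℕ.* 3) · 1#               ≡⟨ cong (_· 1#) q≡1+k*3 ⟨
      q · 1#                           ≡⟨ q·1≡0 ⟩
      0#                               ∎)
      where
      c³≡1 : c * (c * c) ≡ 1#
      c³≡1 = x²+x+1≡0⇒x³≡1 c²+c+1≡0
      c²≡1 : c * c ≡ 1#
      c²≡1 = begin
        c * c                          ≡⟨ cong (c *_) (*-identityʳ c) ⟨
        c * (c * 1#)                   ≡⟨ cong (λ t → c * (c * t)) (x³≡1⇒x^[k*3]≡1 c³≡1 k) ⟨
        c * (c * c ^ (k ℕ.* 3))        ≡⟨ cong (λ m → c ^ suc m) q≡1+k*3 ⟨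
        c ^ suc q                      ≡⟨ ∈-μ⁻ c∈μ ⟩
        1#                             ∎
      c≡1 : c ≡ 1#
      c≡1 = trans (sym (*-identityʳ c)) (trans (cong (c *_) (sym c²≡1)) c³≡1)
      3·1≡0 : 3 · 1# ≡ 0#
      3·1≡0 = trans (sym 1*1+1+1≡3·1) (subst (λ x → x * x + x + 1# ≡ 0#) c≡1 c²+c+1≡0)

  S≡1 : q % 3 ≡ 0 → S ≡ 1
  S≡1 q%3≡0 = begin
    S                                    ≡⟨ S≡count-x²+x+1 ⟩
    count (λ c → c * c + c + 1# ≟ 0#) μ  ≡⟨ count-cong _ (_≟ 1#) μ (λ _ → mk⇔ root≡1 λ { refl → 1²+1+1≡0 }) ⟩
    count (_≟ 1#) μ                      ≡⟨ count-≡-unique _≟_ μ! 1∈μ ⟩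
    1                                    ∎
    where
    -- 3 ∣ q = p^r forces p = 3, so 1 is a (double) root of x² + x + 1.
    3∣q : 3 ∣ q
    3∣q = divides (q / 3) (trans q≡q%3+[q/3]*3 (cong (ℕ._+ (q / 3) ℕ.* 3) q%3≡0))
    p≡3 : p ≡ 3
    p≡3 with prime⇒irreducible p-prime (prime∣m^k⇒prime∣m p r prime[3] 3∣q)
    ... | inj₁ ()
    ... | inj₂ 3≡p = sym 3≡p
    1²+1+1≡0 : 1# * 1# + 1# + 1# ≡ 0#
    1²+1+1≡0 = trans 1*1+1+1≡3·1 (subst (λ m → m · 1# ≡ 0#) p≡3 p·1≡0)
    root≡1 : ∀ {c} → c * c + c + 1# ≡ 0# → c ≡ 1#
    root≡1 c²+c+1≡0 with x²+x+1-roots 1²+1+1≡0 c²+c+1≡0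
    ... | inj₁ c≡1   = c≡1
    ... | inj₂ c≡1*1 = trans c≡1*1 (*-identityʳ 1#)

  1+q≡[1+q/3]*3 : q % 3 ≡ 2 → suc q ≡ suc (q / 3) ℕ.* 3
  1+q≡[1+q/3]*3 q%3≡2 = cong suc (trans q≡q%3+[q/3]*3 (cong (ℕ._+ (q / 3) ℕ.* 3) q%3≡2))

  x³≡1⇒x∈μ : q % 3 ≡ 2 → ∀ {x} → x * (x * x) ≡ 1# → x ∈ μ
  x³≡1⇒x∈μ q%3≡2 {x} x³≡1 =
    ∈-μ⁺ (trans (cong (x ^_) (1+q≡[1+q/3]*3 q%3≡2)) (x³≡1⇒x^[k*3]≡1 x³≡1 (suc (q / 3))))

  nontrivial-cube-root : q % 3 ≡ 2 → Σ Carrier (λ ω → ω ≢ 1# × ω * (ω * ω) ≡ 1#)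
  nontrivial-cube-root q%3≡2 = cube-root (∃-nonzero-x^t≢1 1≤t t<q²∸1)
    where
    t : ℕ
    t = e ℕ.* suc (q / 3)
    q²∸1≡t*3 : q ℕ.^ 2 ∸ 1 ≡ t ℕ.* 3
    q²∸1≡t*3 =
      trans q²∸1≡e*[1+q] (trans (cong (e ℕ.*_) (1+q≡[1+q/3]*3 q%3≡2)) (sym (ℕ.*-assoc e (suc (q / 3)) 3)))
    1≤t : 1 ≤ t
    1≤t = ℕ.*-mono-≤ 1≤e (s≤s z≤n)
    t<q²∸1 : t < q ℕ.^ 2 ∸ 1
    t<q²∸1 = subst (t <_) (sym q²∸1≡t*3) (ℕ.m<m*n t 3 {{ℕ.>-nonZero 1≤t}} (s≤s (s≤s z≤n)))
    cube-root : Σ Carrier (λ x → x ∈ nonzero × x ^ t ≢ 1#) → Σ Carrier (λ ω → ω ≢ 1# × ω * (ω * ω) ≡ 1#)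
    cube-root (x , x∈ , x^t≢1) = x ^ t , x^t≢1 , (begin
      x ^ t * (x ^ t * x ^ t) ≡⟨ cong (λ u → x ^ t * (x ^ t * u)) (*-identityʳ (x ^ t)) ⟨
      (x ^ t) ^ 3             ≡⟨ ^-assocʳ x t 3 ⟩
      x ^ (t ℕ.* 3)           ≡⟨ cong (x ^_) q²∸1≡t*3 ⟨
      x ^ (q ℕ.^ 2 ∸ 1)       ≡⟨ fermat (∈-nonzero⁻ x∈) ⟩
      1#                      ∎)

  count-x²+x+1≡2 : q % 3 ≡ 2 → ∀ {ω} → ω ≢ 1# → ω * (ω * ω) ≡ 1# →
                   count (λ c → c * c + c + 1# ≟ 0#) μ ≡ 2
  count-x²+x+1≡2 q%3≡2 {ω} ω≢1 ω³≡1 = begin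
    count (λ c → c * c + c + 1# ≟ 0#) μ   ≡⟨ count-cong _ ((_≟ ω) ∪? (_≟ ω * ω)) μ
                                                (λ _ → mk⇔ (x²+x+1-roots ω²+ω+1≡0) ω-or-ω²) ⟩
    count ((_≟ ω) ∪? (_≟ ω * ω)) μ        ≡⟨ count-∪ (_≟ ω) (_≟ ω * ω) (λ { refl → ω≢ω² }) μ ⟩
    count (_≟ ω) μ ℕ.+ count (_≟ ω * ω) μ ≡⟨ cong₂ ℕ._+_ (count-≡-unique _≟_ μ! (root∈μ ω²+ω+1≡0))
                                                          (count-≡-unique _≟_ μ! (root∈μ (x²+x+1≡0⇒[x²]²+x²+1≡0 ω²+ω+1≡0))) ⟩
    2                                     ∎
    where
    root∈μ : ∀ {c} → c * c + c + 1# ≡ 0# → c ∈ μ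
    root∈μ c²+c+1≡0 = x³≡1⇒x∈μ q%3≡2 (x²+x+1≡0⇒x³≡1 c²+c+1≡0)
    ω²+ω+1≡0 : ω * ω + ω + 1# ≡ 0#
    ω²+ω+1≡0 with x³≡1⇒x≡1⊎x²+x+1≡0 ω³≡1
    ... | inj₁ ω≡1       = contradiction ω≡1 ω≢1
    ... | inj₂ ω²+ω+1≡0 = ω²+ω+1≡0
    ω≢ω² : ω ≢ ω * ω
    ω≢ω² ω≡ω² = ω≢1 (sym (*-cancelˡ ω≢0 (trans (*-identityʳ ω) ω≡ω²)))
      where
      ω≢0 : ω ≢ 0#
      ω≢0 ω≡0 = 1≢0 (trans (sym ω³≡1) (trans (cong (_* (ω * ω)) ω≡0) (zeroˡ (ω * ω))))
    ω-or-ω² : ∀ {c} → c ≡ ω ⊎ c ≡ ω * ω → c * c + c + 1# ≡ 0#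
    ω-or-ω² (inj₁ refl) = ω²+ω+1≡0
    ω-or-ω² (inj₂ refl) = x²+x+1≡0⇒[x²]²+x²+1≡0 ω²+ω+1≡0

  S≡2 : q % 3 ≡ 2 → S ≡ 2
  S≡2 q%3≡2 = trans S≡count-x²+x+1 (count-x²+x+1≡2 q%3≡2 (proj₁ (proj₂ root)) (proj₂ (proj₂ root)))
    where
    root : Σ Carrier (λ ω → ω ≢ 1# × ω * (ω * ω) ≡ 1#)
    root = nontrivial-cube-root q%3≡2

open import Data.Nat using (ℕ; _+_; _*_; _∸_; _^_; _%_; _≤_)
open import Data.Nat.Primality using (Prime)
open import Data.Product using (_×_)
open import Relation.Binary.PropositionalEquality using (_≡_)

corollary8 : (p r : ℕ) → Prime p → 1 ≤ r →
    (F : FiniteField ((p ^ r) ^ 2)) →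
    let q = p ^ r
        N = FiniteField.curvePointCount F (q ∸ 1)
    in (q % 3 ≡ 1 → N ≡ 3 * (q ∸ 1))
       × (q % 3 ≡ 0 → N ≡ 3 * (q ∸ 1) + (q ∸ 1) ^ 2)
       × (q % 3 ≡ 2 → N ≡ 3 * (q ∸ 1) + 2 * (q ∸ 1) ^ 2)
corollary8 p r p-prime 1≤r F =
    (λ q%3≡1 → trans (N≡3e+se² (S≡0 q%3≡1)) (+-identityʳ (3 * e)))
  , (λ q%3≡0 → trans (N≡3e+se² (S≡1 q%3≡0)) (cong (3 * e +_) (*-identityˡ (e ^ 2))))
  , (λ q%3≡2 → N≡3e+se² (S≡2 q%3≡2))
  where
  open FermatCurveOverFq² p r p-prime 1≤r F using (e; S; S≡0; S≡1; S≡2; curvePointCount≡3e+Se²)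
  open import Data.Nat.Properties using (+-identityʳ; *-identityˡ)
  open import Data.Product using (_,_)
  open import Relation.Binary.PropositionalEquality using (trans; cong; subst)
  N≡3e+se² : ∀ {s} → S ≡ s → FiniteField.curvePointCount F e ≡ 3 * e + s * e ^ 2
  N≡3e+se² S≡s = subst (λ s → FiniteField.curvePointCount F e ≡ 3 * e + s * e ^ 2) S≡s curvePointCount≡3e+Se²
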